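{- Let $k\ge2$, $\ell\in\mathbb{N}_0$, and let $a\colon\mathbb{N}_0\to\{+1,-1\}$ be a pattern counting sequence of length $\le\ell$. Then there exists a unique pattern counting sequence $b$ of length $\le\ell$ satisfying $b(kn)=b(n)$ for all $n\in\mathbb{N}_0$ such that $a/b$ is periodic with period $k^{\ell-1}$.
   Context: $\Sigma_k=\{\mathtt 0,\dots,k-1\}$; $(n)_k$ the base-$k$ expansion without leading zeros. For a word $v$ not of the form $\mathtt 0^j$ ($j\ge0$), $\#(v,n)$ is the number of pairs of words $(x,y)$ with $\mathtt 0^{|v|-1}(n)_k=xvy$. $A$ is admissible if finite and containing no word of the form $\mathtt 0^j$ ($j\ge 0$); $a_A(n)=(-1)^{\sum_{v\in A}\#(v,n)}$. A pattern counting sequence of length $\le\ell$ is $a_A$ with $A$ admissible and all words of $A$ of length $\le\ell$. $a/b$ is the pointwise quotient. -}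

module Defs where

open import Data.Nat using (ℕ; zero; suc; _+_; _*_; _∸_; _^_; _≤_; NonZero)
open import Data.Nat.ListAction using (sum)
open import Data.Nat.DivMod using (_/_; _mod_)
open import Data.Fin using (Fin; zero; suc)
import Data.Fin as Fin
open import Data.Bool using (Bool; true; false; _∧_; if_then_else_)
open import Data.List using (List; []; _∷_; _++_; [_]; length; replicate; map)
open import Data.List.Relation.Unary.All using (All)
open import Data.List.Relation.Unary.Unique.Propositional using (Unique)
open import Data.Integer using (ℤ; -[1+_]) renaming (_^_ to _^ℤ_; _*_ to _*ℤ_)
open import Data.Product using (Σ; _×_)
open import Relation.Binary.PropositionalEquality using (_≡_)
open import Relation.Nullary using (¬_)
open import Relation.Nullary.Decidable using (⌊_⌋)

Word : ℕ → Set
Word k = List (Fin k)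

module _ (k : ℕ) .{{_ : NonZero k}} where

  -- base-k expansion with fuel, most significant digit first, no leading zeros;
  -- the expansion of 0 is the empty word.  Fuel n suffices for k ≥ 2.
  digitsFuel : ℕ → ℕ → Word k
  digitsFuel zero    _       = []
  digitsFuel (suc f) zero    = []
  digitsFuel (suc f) (suc m) = digitsFuel f (suc m / k) ++ [ suc m mod k ]

  expansion : ℕ → Word k
  expansion n = digitsFuel n n

  zeroDigit : Fin k
  zeroDigit = 0 mod k

  isPrefix : Word k → Word k → Bool
  isPrefix []      _       = true
  isPrefix (a ∷ v) []      = false
  isPrefix (a ∷ v) (b ∷ w) = ⌊ a Fin.≟ b ⌋ ∧ isPrefix v w

  -- number of pairs (x , y) with w = x v y
  --  (= number of suffixes of w, including w and [], having v as a prefix)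
  occurrences : Word k → Word k → ℕ
  occurrences v []      = if isPrefix v [] then 1 else 0
  occurrences v (c ∷ w) = (if isPrefix v (c ∷ w) then 1 else 0) + occurrences v w

  #occ : Word k → ℕ → ℕ
  #occ v n = occurrences v (replicate (length v ∸ 1) zeroDigit ++ expansion n)

  IsZeroWord : Word k → Set
  IsZeroWord v = All (λ c → Fin.toℕ c ≡ 0) v

  Admissible : List (Word k) → Set
  Admissible A = Unique A × All (λ v → ¬ IsZeroWord v) A

  aSeq : List (Word k) → ℕ → ℤ
  aSeq A n = -[1+ 0 ] ^ℤ sum (map (λ v → #occ v n) A)

  IsPCS : ℕ → (ℕ → ℤ) → Set
  IsPCS ℓ a = Σ (List (Word k)) λ A →
    Admissible A × All (λ v → length v ≤ ℓ) A × (∀ n → a n ≡ aSeq A n)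

-- pointwise quotient a/b of ±1-valued sequences (for x , y ∈ {±1}, x / y = x * y)
_/ₛ_ : (ℕ → ℤ) → (ℕ → ℤ) → ℕ → ℤ
(a /ₛ b) n = a n *ℤ b n

Periodic : ℕ → (ℕ → ℤ) → Set
Periodic p f = ∀ n → f (n + p) ≡ f n

module Submission where

-- For a word x and the padded expansion W = 0^{|x|-1}(n)_k, every occurrence of x
-- in W is either followed by some letter d (an occurrence of xd) or sits at the end of W, so
--     #(x,n) = Σ_d #(xd,n) + [x is a suffix of W].
-- The last term only depends on the |x| lowest digits of n, hence is k^(ℓ-1)-periodic when
-- |x| < ℓ.  Applied to x with v = x0 this expresses #(v,n) mod 2 through #(x,n), words x d
-- with d ≠ 0, and a periodic remainder; iterating, every admissible word reduces modulo 2 to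
-- words ending in a nonzero digit plus a periodic remainder (a "reduction", see below).  Counts
-- of words ending in a nonzero digit are invariant under n ↦ kn, since (kn)_k = (n)_k 0.
-- Keeping the words that occur an odd number of times yields an admissible set B, and b = a_B.
--
-- Uniqueness.  If f is k-invariant and a/f is k^j-periodic, then f(n) = f(k^j n) is determined
-- by a and f(0); and f(0) = 1 for every pattern counting sequence.

open import Defs
open import Data.Nat using (ℕ; zero; suc; _+_; _*_; _∸_; _^_; _≤_; _<_; z≤n; s≤s; s≤s⁻¹; NonZero)
open import Data.Nat.Properties
  using ( +-identityʳ; +-comm; +-assoc; *-comm; *-assoc; *-identityˡ; +-∸-assoc; n∸n≡0
        ; m∸[m∸n]≡n; m∸n≤m; ∸-monoˡ-≤; ≤-refl; ≤-trans; ≤-reflexive; n≤1+n; <-irrefl; <-trans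
        ; n<1+n; m≤n⇒m<n∨m≡n; +-monoʳ-≤; +-0-commutativeMonoid; +-commutativeSemigroup )
open import Data.Nat.DivMod
  using ( _/_; _%_; _mod_; m%n<n; m/n<m; m*n/n≡m; m*n%n≡0; [m+kn]%n≡m%n; +-distrib-/-∣ʳ
        ; /-congˡ; %-congˡ )
open import Data.Nat.Divisibility using (divides)
open import Data.Nat.ListAction using (sum)
open import Data.Nat.ListAction.Properties using (sum-++)
open import Data.Integer using (ℤ; 1ℤ; -[1+_])
import Data.Integer as ℤ
import Data.Integer.Properties as ℤₚ
open import Data.Fin using (Fin; zero; suc)
import Data.Fin as F
open import Data.Fin.Properties using (fromℕ<-cong)
open import Data.Bool using (Bool; true; false; if_then_else_; _∧_)
open import Data.Bool.Properties using (∧-identityʳ; ∧-zeroʳ)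
open import Data.List using (List; []; _∷_; _++_; [_]; length; replicate; map; drop; tabulate)
open import Data.List.Properties
  using ( ≡-dec; length-++; length-++-≤ˡ; length-replicate; ++-identityʳ; ++-assoc; map-++
        ; map-tabulate; drop-all )
open import Data.List.Reverse using (Reverse; []; _∶_∶ʳ_; reverseView)
open import Data.List.Relation.Unary.All using (All; []; _∷_)
import Data.List.Relation.Unary.All as All
open import Data.List.Relation.Unary.All.Properties using (++⁺; ++⁻ʳ; tabulate⁺)
open import Data.List.Relation.Unary.AllPairs using ([]; _∷_)
open import Data.List.Relation.Unary.Unique.Propositional using (Unique)
open import Data.Product using (Σ; _×_; _,_)
open import Data.Sum using (inj₁; inj₂)
open import Data.Empty using (⊥-elim)
open import Function using (_∘_)
open import Relation.Nullary using (¬_; yes; no)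
open import Relation.Nullary.Decidable using (does; isYes≗does; dec-false)
open import Relation.Binary.Definitions using (DecidableEquality)
open import Relation.Binary.PropositionalEquality
  using (_≡_; _≢_; refl; sym; trans; cong; cong₂; subst; module ≡-Reasoning)
open import Algebra.Properties.CommutativeMonoid.Sum +-0-commutativeMonoid
  using (∑-distrib-+; sum-cong-≗; sum-replicate-zero)
  renaming (sum to ∑)
open import Level using (0ℓ)
open import Relation.Binary.Bundles using (Setoid)
import Relation.Binary.Reasoning.Setoid
open import Algebra.Properties.CommutativeSemigroup +-commutativeSemigroup
  using (interchange; x∙yz≈y∙xz; xy∙z≈z∙yx)

sgn : ℕ → ℤ
sgn m = -[1+ 0 ] ℤ.^ m

sgn-+ : ∀ m n → sgn (m + n) ≡ sgn m ℤ.* sgn n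
sgn-+ = ℤₚ.^-distribˡ-+-* -[1+ 0 ]

sgn-square : ∀ m → sgn m ℤ.* sgn m ≡ 1ℤ
sgn-square zero          = refl
sgn-square (suc zero)    = refl
sgn-square (suc (suc m)) = trans (cong (λ s → s ℤ.* s) sgn-2+) (sgn-square m)
  where
  sgn-2+ : sgn (2 + m) ≡ sgn m
  sgn-2+ = trans (sym (ℤₚ.*-assoc -[1+ 0 ] -[1+ 0 ] (sgn m))) (ℤₚ.*-identityˡ (sgn m))

-- Congruence modulo 2, expressed through signs (a record, so that both sides can be inferred).
infix 4 _≡₂_
record _≡₂_ (m n : ℕ) : Set where
  constructor same-sign
  field sign-eq : sgn m ≡ sgn n
open _≡₂_ public

≡₂-setoid : Setoid 0ℓ 0ℓ
≡₂-setoid = record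
  { Carrier       = ℕ
  ; _≈_           = _≡₂_
  ; isEquivalence = record
    { refl  = same-sign refl
    ; sym   = λ p → same-sign (sym (sign-eq p))
    ; trans = λ p q → same-sign (trans (sign-eq p) (sign-eq q))
    }
  }

module ≡₂-Reasoning = Relation.Binary.Reasoning.Setoid ≡₂-setoid
open Setoid ≡₂-setoid public using () renaming (refl to ≡₂-refl; sym to ≡₂-sym; trans to ≡₂-trans)

≡⇒≡₂ : ∀ {m n} → m ≡ n → m ≡₂ n
≡⇒≡₂ m≡n = same-sign (cong sgn m≡n)

≡₂-+ : ∀ {a a′ b b′} → a ≡₂ a′ → b ≡₂ b′ → a + b ≡₂ a′ + b′
≡₂-+ {a} {a′} {b} {b′} (same-sign p) (same-sign q) =
  same-sign (trans (sgn-+ a b) (trans (cong₂ ℤ._*_ p q) (sym (sgn-+ a′ b′))))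

≡₂-twice : ∀ m n → m + (m + n) ≡₂ n
≡₂-twice m n = same-sign (begin
  sgn (m + (m + n))                ≡⟨ cong sgn (sym (+-assoc m m n)) ⟩
  sgn ((m + m) + n)                ≡⟨ sgn-+ (m + m) n ⟩
  sgn (m + m) ℤ.* sgn n            ≡⟨ cong (ℤ._* sgn n) (trans (sgn-+ m m) (sgn-square m)) ⟩
  1ℤ ℤ.* sgn n                     ≡⟨ ℤₚ.*-identityˡ (sgn n) ⟩
  sgn n                            ∎)
  where open ≡-Reasoning

≡₂-shift : ∀ a b c → a ≡₂ c + b → a + b ≡₂ c
≡₂-shift a b c h = begin
  a + b          ≈⟨ ≡₂-+ h ≡₂-refl ⟩
  (c + b) + b    ≡⟨ xy∙z≈z∙yx c b b ⟩
  b + (b + c)    ≈⟨ ≡₂-twice b c ⟩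
  c              ∎
  where open ≡₂-Reasoning

≡₂-unshift : ∀ a b c → a + b ≡₂ c → a ≡₂ c + b
≡₂-unshift a b c h = begin
  a              ≈⟨ ≡₂-sym (≡₂-twice b a) ⟩
  b + (b + a)    ≡⟨ xy∙z≈z∙yx a b b ⟨
  (a + b) + b    ≈⟨ ≡₂-+ h ≡₂-refl ⟩
  c + b          ∎
  where open ≡₂-Reasoning

sgn-quotient : ∀ x y r → x ≡₂ y + r → sgn x ℤ.* sgn y ≡ sgn r
sgn-quotient x y r h =
  trans (sym (sgn-+ x y)) (sign-eq (≡₂-shift x y r (≡₂-trans h (≡⇒≡₂ (+-comm y r)))))

invariant-pow : ∀ k (f : ℕ → ℤ) → (∀ n → f (k * n) ≡ f n) → ∀ j n → f (k ^ j * n) ≡ f n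
invariant-pow k f inv zero    n = cong f (*-identityˡ n)
invariant-pow k f inv (suc j) n =
  trans (cong f (*-assoc k (k ^ j) n)) (trans (inv _) (invariant-pow k f inv j n))

periodic-multiple : ∀ p (F : ℕ → ℤ) → Periodic p F → ∀ j → F (j * p) ≡ F 0
periodic-multiple p F per zero    = refl
periodic-multiple p F per (suc j) =
  trans (cong F (+-comm p (j * p))) (trans (per (j * p)) (periodic-multiple p F per j))

-- If a is ±1-valued, f is k-invariant and a/f is k^j-periodic, then f is determined by a and
-- f 0:  f n = f (k^j n) = a (k^j n) · (a/f)(k^j n) = a (k^j n) · a 0 · f 0.
invariant-determined : ∀ k j (a f : ℕ → ℤ) → (∀ m → a m ℤ.* a m ≡ 1ℤ) →
  (∀ n → f (k * n) ≡ f n) → Periodic (k ^ j) (a /ₛ f) →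
  ∀ n → f n ≡ a (k ^ j * n) ℤ.* (a 0 ℤ.* f 0)
invariant-determined k j a f a² inv per n = begin
  f n                                ≡⟨ sym (ℤₚ.*-identityˡ (f n)) ⟩
  1ℤ ℤ.* f n                         ≡⟨ cong (ℤ._* f n) (sym (a² m)) ⟩
  (a m ℤ.* a m) ℤ.* f n              ≡⟨ ℤₚ.*-assoc (a m) (a m) (f n) ⟩
  a m ℤ.* (a m ℤ.* f n)              ≡⟨ cong (λ t → a m ℤ.* (a m ℤ.* t)) (sym (invariant-pow k f inv j n)) ⟩
  a m ℤ.* (a /ₛ f) m                 ≡⟨ cong (λ t → a m ℤ.* (a /ₛ f) t) (*-comm (k ^ j) n) ⟩
  a m ℤ.* (a /ₛ f) (n * k ^ j)       ≡⟨ cong (a m ℤ.*_) (periodic-multiple (k ^ j) (a /ₛ f) per n) ⟩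
  a m ℤ.* (a 0 ℤ.* f 0)              ∎
  where
  open ≡-Reasoning
  m = k ^ j * n

invariant-unique : ∀ k j (a f g : ℕ → ℤ) → (∀ m → a m ℤ.* a m ≡ 1ℤ) →
  (∀ n → f (k * n) ≡ f n) → Periodic (k ^ j) (a /ₛ f) →
  (∀ n → g (k * n) ≡ g n) → Periodic (k ^ j) (a /ₛ g) →
  f 0 ≡ g 0 → ∀ n → f n ≡ g n
invariant-unique k j a f g a² f-inv f-per g-inv g-per f0≡g0 n =
  trans (invariant-determined k j a f a² f-inv f-per n)
    (trans (cong (λ t → a (k ^ j * n) ℤ.* (a 0 ℤ.* t)) f0≡g0)
      (sym (invariant-determined k j a g a² g-inv g-per n)))

weight : {A : Set} → (A → ℕ) → List A → ℕ
weight w L = sum (map w L)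

weight-++ : {A : Set} (w : A → ℕ) (L M : List A) → weight w (L ++ M) ≡ weight w L + weight w M
weight-++ w L M = trans (cong sum (map-++ w L M)) (sum-++ (map w L) (map w M))

-- For a type with decidable equality, the odd part of a list: a duplicate-free list that has
-- the same weight modulo 2 as the list itself, for every weight.
module OddPart {A : Set} (_≟_ : DecidableEquality A) where

  toggle : A → List A → List A
  toggle x []       = [ x ]
  toggle x (y ∷ ys) with x ≟ y
  ... | yes _ = ys
  ... | no  _ = y ∷ toggle x ys

  oddPart : List A → List A
  oddPart []      = []
  oddPart (x ∷ L) = toggle x (oddPart L)

  toggle-All : ∀ {P : A → Set} x ys → P x → All P ys → All P (toggle x ys)
  toggle-All x []       px _          = px ∷ []
  toggle-All x (y ∷ ys) px (py ∷ pys) with x ≟ y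
  ... | yes _ = pys
  ... | no  _ = py ∷ toggle-All x ys px pys

  toggle-Unique : ∀ x ys → Unique ys → Unique (toggle x ys)
  toggle-Unique x []       _            = [] ∷ []
  toggle-Unique x (y ∷ ys) (y∉ys ∷ uys) with x ≟ y
  ... | yes _   = uys
  ... | no  x≢y = toggle-All {P = y ≢_} x ys (x≢y ∘ sym) y∉ys ∷ toggle-Unique x ys uys

  toggle-parity : ∀ (w : A → ℕ) x ys → w x + weight w ys ≡₂ weight w (toggle x ys)
  toggle-parity w x []       = ≡₂-refl
  toggle-parity w x (y ∷ ys) with x ≟ y
  ... | yes refl = ≡₂-twice (w x) (weight w ys)
  ... | no  _    = ≡₂-trans (≡⇒≡₂ (x∙yz≈y∙xz (w x) (w y) (weight w ys)))
                            (≡₂-+ ≡₂-refl (toggle-parity w x ys))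

  oddPart-All : ∀ {P : A → Set} L → All P L → All P (oddPart L)
  oddPart-All []      _          = []
  oddPart-All (x ∷ L) (px ∷ pL) = toggle-All x (oddPart L) px (oddPart-All L pL)

  oddPart-Unique : ∀ L → Unique (oddPart L)
  oddPart-Unique []      = []
  oddPart-Unique (x ∷ L) = toggle-Unique x (oddPart L) (oddPart-Unique L)

  oddPart-parity : ∀ (w : A → ℕ) L → weight w L ≡₂ weight w (oddPart L)
  oddPart-parity w []      = ≡₂-refl
  oddPart-parity w (x ∷ L) =
    ≡₂-trans (≡₂-+ ≡₂-refl (oddPart-parity w L)) (toggle-parity w x (oddPart L))

ind : Bool → ℕ
ind b = if b then 1 else 0

∑-indicator : ∀ {n} (c : Fin n) → ∑ (λ d → ind (does (d F.≟ c))) ≡ 1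
∑-indicator {suc n} zero    = cong suc (sum-replicate-zero n)
∑-indicator {suc n} (suc c) = ∑-indicator c

sum-tabulate : ∀ {n} (f : Fin n → ℕ) → sum (tabulate f) ≡ ∑ f
sum-tabulate {zero}  f = refl
sum-tabulate {suc n} f = cong (f zero +_) (sum-tabulate (f ∘ suc))

drop-++ : ∀ {A : Set} j (W ys : List A) → j ≤ length W → drop j (W ++ ys) ≡ drop j W ++ ys
drop-++ zero    W       ys _         = refl
drop-++ (suc j) (a ∷ W) ys (s≤s j≤W) = drop-++ j W ys j≤W

drop-replicate : ∀ {A : Set} i j (x : A) → drop i (replicate j x) ≡ replicate (j ∸ i) x
drop-replicate zero    j       x = refl
drop-replicate (suc i) zero    x = refl
drop-replicate (suc i) (suc j) x = drop-replicate i j x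

replicate-snoc : ∀ {A : Set} L (x : A) → replicate L x ++ [ x ] ≡ replicate (suc L) x
replicate-snoc zero    x = refl
replicate-snoc (suc L) x = cong (x ∷_) (replicate-snoc L x)

module Words (k′ : ℕ) where

  k : ℕ
  k = suc k′

  infix 4 _≟ʷ_
  _≟ʷ_ : DecidableEquality (Word k)
  _≟ʷ_ = ≡-dec F._≟_

  pre : Word k → Word k → Bool
  pre = isPrefix k

  occ : Word k → Word k → ℕ
  occ = occurrences k

  zeros : ℕ → Word k
  zeros j = replicate j zero

  ind-≢ : ∀ x y → x ≢ y → ind (does (x ≟ʷ y)) ≡ 0
  ind-≢ x y x≢y = cong ind (dec-false (x ≟ʷ y) x≢y)

  ind-length : ∀ x y → length x ≢ length y → ind (does (x ≟ʷ y)) ≡ 0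
  ind-length x y ne = ind-≢ x y (ne ∘ cong length)

  length-snoc : ∀ (x : Word k) d → length (x ++ [ d ]) ≡ suc (length x)
  length-snoc x d = trans (length-++ x) (+-comm (length x) 1)

  prefix-split : ∀ x s →
    ind (pre x s) ≡ ∑ (λ d → ind (pre (x ++ [ d ]) s)) + ind (does (x ≟ʷ s))
  prefix-split [] [] = sym (cong (_+ 1) (sum-replicate-zero k))
  prefix-split [] (c ∷ s) = sym (trans (+-identityʳ _)
    (trans (sum-cong-≗ (λ d → cong ind (trans (∧-identityʳ _) (isYes≗does (d F.≟ c)))))
           (∑-indicator c)))
  prefix-split (a ∷ x) [] = sym (trans (+-identityʳ _) (sum-replicate-zero k))
  prefix-split (a ∷ x) (c ∷ s) with a F.≟ c
  ... | yes _ = prefix-split x s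
  ... | no  _ = sym (cong (_+ 0) (sum-replicate-zero k))

  endCount : Word k → Word k → ℕ
  endCount x []      = ind (does (x ≟ʷ []))
  endCount x (c ∷ W) = ind (does (x ≟ʷ c ∷ W)) + endCount x W

  -- Splitting occurrences by the following letter: each occurrence of x in W is either an
  -- occurrence of some x d or a suffix of W.
  occurrences-split : ∀ x W → occ x W ≡ ∑ (λ d → occ (x ++ [ d ]) W) + endCount x W
  occurrences-split x []      = prefix-split x []
  occurrences-split x (c ∷ W) = begin
    ind (pre x (c ∷ W)) + occ x W
      ≡⟨ cong₂ _+_ (prefix-split x (c ∷ W)) (occurrences-split x W) ⟩
    (P + E) + (O + E′)
      ≡⟨ interchange P E O E′ ⟩
    (P + O) + (E + E′)
      ≡⟨ cong (_+ (E + E′)) (sym (∑-distrib-+ (λ d → ind (pre (x ++ [ d ]) (c ∷ W)))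
                                                 (λ d → occ (x ++ [ d ]) W))) ⟩
    ∑ (λ d → occ (x ++ [ d ]) (c ∷ W)) + endCount x (c ∷ W)
      ∎
    where
    open ≡-Reasoning
    P = ∑ (λ d → ind (pre (x ++ [ d ]) (c ∷ W)))
    E = ind (does (x ≟ʷ c ∷ W))
    O = ∑ (λ d → occ (x ++ [ d ]) W)
    E′ = endCount x W

  lastLetters : ℕ → Word k → Word k
  lastLetters L W = drop (length W ∸ L) W

  lastLetters-cons : ∀ L c W → L ≤ length W → lastLetters L (c ∷ W) ≡ lastLetters L W
  lastLetters-cons L c W L≤W = cong (λ j → drop j (c ∷ W)) (+-∸-assoc 1 L≤W)

  lastLetters-snoc : ∀ L W r → L ≤ length W → lastLetters (suc L) (W ++ [ r ]) ≡ lastLetters L W ++ [ r ]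
  lastLetters-snoc L W r L≤W =
    trans (cong (λ j → drop j (W ++ [ r ])) (cong (_∸ suc L) (length-snoc W r)))
          (drop-++ (length W ∸ L) W [ r ] (m∸n≤m _ L))

  endCount-short : ∀ x W → length W < length x → endCount x W ≡ 0
  endCount-short x []      W<x = ind-length x [] (λ e → <-irrefl (sym e) W<x)
  endCount-short x (c ∷ W) W<x =
    cong₂ _+_ (ind-length x (c ∷ W) (λ e → <-irrefl (sym e) W<x)) (endCount-short x W (<-trans (n<1+n _) W<x))

  endCount-last : ∀ x W → length x ≤ length W → endCount x W ≡ ind (does (x ≟ʷ lastLetters (length x) W))
  endCount-last []      []      _ = refl
  endCount-last x (c ∷ W) x≤W with m≤n⇒m<n∨m≡n x≤W
  ... | inj₁ (s≤s x≤W′) = begin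
    ind (does (x ≟ʷ c ∷ W)) + endCount x W
      ≡⟨ cong₂ _+_ (ind-length x (c ∷ W) (λ e → <-irrefl e (s≤s x≤W′))) (endCount-last x W x≤W′) ⟩
    ind (does (x ≟ʷ lastLetters (length x) W))
      ≡⟨ cong (λ w → ind (does (x ≟ʷ w))) (sym (lastLetters-cons (length x) c W x≤W′)) ⟩
    ind (does (x ≟ʷ lastLetters (length x) (c ∷ W)))
      ∎
    where open ≡-Reasoning
  ... | inj₂ x≡W = begin
    ind (does (x ≟ʷ c ∷ W)) + endCount x W
      ≡⟨ cong (ind (does (x ≟ʷ c ∷ W)) +_) (endCount-short x W (≤-reflexive (sym x≡W))) ⟩
    ind (does (x ≟ʷ c ∷ W)) + 0
      ≡⟨ +-identityʳ _ ⟩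
    ind (does (x ≟ʷ c ∷ W))
      ≡⟨ cong (λ j → ind (does (x ≟ʷ drop j (c ∷ W))))
              (sym (trans (cong (length (c ∷ W) ∸_) x≡W) (n∸n≡0 (length (c ∷ W))))) ⟩
    ind (does (x ≟ʷ lastLetters (length x) (c ∷ W)))
      ∎
    where open ≡-Reasoning

  prefix-length : ∀ x s → pre x s ≡ true → length x ≤ length s
  prefix-length []      s       _ = z≤n
  prefix-length (a ∷ x) (c ∷ s) e with a F.≟ c
  ... | yes _ = s≤s (prefix-length x s e)

  prefix-++ : ∀ x y s → pre (x ++ y) s ≡ true → pre x s ≡ true
  prefix-++ []      y s       _ = refl
  prefix-++ (a ∷ x) y (c ∷ s) e with a F.≟ c
  ... | yes _ = prefix-++ x y s e

  prefix-of-zeros : ∀ x j W → pre x (zeros j ++ W) ≡ true → length x ≤ j → IsZeroWord k x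
  prefix-of-zeros []      j       W _ _ = []
  prefix-of-zeros (a ∷ x) (suc j) W e (s≤s x≤j) with a F.≟ zero
  ... | yes refl = refl ∷ prefix-of-zeros x j W e x≤j

  occurrences-zeros : ∀ w j → ¬ IsZeroWord k w → occ w (zeros j) ≡ 0
  occurrences-zeros []      j       nz = ⊥-elim (nz [])
  occurrences-zeros (a ∷ w) zero    nz = refl
  occurrences-zeros (a ∷ w) (suc j) nz = cong₂ _+_ not-prefix (occurrences-zeros (a ∷ w) j nz)
    where
    not-prefix : ind (pre (a ∷ w) (zeros (suc j))) ≡ 0
    not-prefix with pre (a ∷ w) (zeros (suc j)) in e
    ... | false = refl
    ... | true  = ⊥-elim (nz (prefix-of-zeros (a ∷ w) (suc j) []
      (trans (cong (pre (a ∷ w)) (++-identityʳ (zeros (suc j)))) e)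
      (subst (length (a ∷ w) ≤_) (length-replicate (suc j)) (prefix-length (a ∷ w) (zeros (suc j)) e))))

  -- #(w , 0) = 0 for every word w other than 0^j, since (0)_k is empty.
  #occ-zero : ∀ w → ¬ IsZeroWord k w → #occ k w 0 ≡ 0
  #occ-zero w nz = trans (cong (occ w) (++-identityʳ (zeros (length w ∸ 1))))
                         (occurrences-zeros w (length w ∸ 1) nz)

  tailMatch : Word k → ℕ → ℕ
  tailMatch x n = endCount x (zeros (length x ∸ 1) ++ expansion k n)

  -- Splitting #(x,n) by the letter following each occurrence.  The extra leading zero in the
  -- padding of x d creates no occurrence of x d, as x is not a word of zeros.
  #occ-split : ∀ x n → ¬ IsZeroWord k x → #occ k x n ≡ ∑ (λ d → #occ k (x ++ [ d ]) n) + tailMatch x n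
  #occ-split []      n nz = ⊥-elim (nz [])
  #occ-split (a ∷ x) n nz =
    trans (occurrences-split (a ∷ x) W) (cong (_+ tailMatch (a ∷ x) n) (sum-cong-≗ padded))
    where
    W : Word k
    W = zeros (length x) ++ expansion k n
    no-leading : ∀ d → ind (pre ((a ∷ x) ++ [ d ]) (zero ∷ W)) ≡ 0
    no-leading d with pre ((a ∷ x) ++ [ d ]) (zero ∷ W) in e
    ... | false = refl
    ... | true  = ⊥-elim (nz (prefix-of-zeros (a ∷ x) (suc (length x)) (expansion k n)
                                (prefix-++ (a ∷ x) [ d ] _ e) ≤-refl))
    padded : ∀ d → occ ((a ∷ x) ++ [ d ]) W ≡ #occ k ((a ∷ x) ++ [ d ]) n
    padded d = sym (trans (cong (λ j → occ ((a ∷ x) ++ [ d ]) (zeros j ++ expansion k n)) (length-snoc x d))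
                          (cong (_+ occ ((a ∷ x) ++ [ d ]) W) (no-leading d)))

  EndsNonzero : Word k → Set
  EndsNonzero w = Σ (Word k) λ y → Σ (Fin k′) λ c → w ≡ y ++ [ suc c ]

  endsNonzero⇒nonzero : ∀ {w} → EndsNonzero w → ¬ IsZeroWord k w
  endsNonzero⇒nonzero (y , c , refl) zw with ++⁻ʳ y zw
  ... | () ∷ _

  pre-nil : ∀ (y : Word k) e → pre (y ++ [ e ]) [] ≡ false
  pre-nil []      e = refl
  pre-nil (a ∷ y) e = refl

  pre-snoc-zero : ∀ y c s → pre (y ++ [ suc c ]) (s ++ [ zero ]) ≡ pre (y ++ [ suc c ]) s
  pre-snoc-zero []      c []      = refl
  pre-snoc-zero []      c (d ∷ s) = refl
  pre-snoc-zero (a ∷ y) c []      = trans (cong (_ ∧_) (pre-nil y (suc c))) (∧-zeroʳ _)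
  pre-snoc-zero (a ∷ y) c (d ∷ s) = cong (_ ∧_) (pre-snoc-zero y c s)

  occurrences-snoc-zero : ∀ y c W → occ (y ++ [ suc c ]) (W ++ [ zero ]) ≡ occ (y ++ [ suc c ]) W
  occurrences-snoc-zero y c []      =
    trans (cong₂ (λ b b′ → ind b + ind b′) (pre-snoc-zero y c []) (pre-nil y (suc c))) (+-identityʳ _)
  occurrences-snoc-zero y c (d ∷ W) =
    cong₂ (λ b m → ind b + m) (pre-snoc-zero y c (d ∷ W)) (occurrences-snoc-zero y c W)

  patternCount : List (Word k) → ℕ → ℕ
  patternCount A n = weight (λ v → #occ k v n) A

  patternCount-zero : ∀ A → All (λ v → ¬ IsZeroWord k v) A → patternCount A 0 ≡ 0
  patternCount-zero []      []          = refl
  patternCount-zero (v ∷ A) (nz ∷ nzs) = cong₂ _+_ (#occ-zero v nz) (patternCount-zero A nzs)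

  pcs-square : ∀ {ℓ f} → IsPCS k ℓ f → ∀ n → f n ℤ.* f n ≡ 1ℤ
  pcs-square (A , _ , _ , f≗) n = trans (cong₂ ℤ._*_ (f≗ n) (f≗ n)) (sgn-square (patternCount A n))

  pcs-at-zero : ∀ {ℓ f} → IsPCS k ℓ f → f 0 ≡ 1ℤ
  pcs-at-zero (A , (_ , nzA) , _ , f≗) = trans (f≗ 0) (cong sgn (patternCount-zero A nzA))

  extensions : Word k → List (Word k)
  extensions x = tabulate (λ i → x ++ [ suc i ])

  patternCount-extensions : ∀ x n → patternCount (extensions x) n ≡ ∑ (λ i → #occ k (x ++ [ suc i ]) n)
  patternCount-extensions x n =
    trans (cong sum (map-tabulate (λ i → x ++ [ suc i ]) (λ v → #occ k v n)))
          (sum-tabulate (λ i → #occ k (x ++ [ suc i ]) n))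

  #occ-split-zero : ∀ x n → ¬ IsZeroWord k x →
    #occ k x n ≡ #occ k (x ++ [ zero ]) n + (patternCount (extensions x) n + tailMatch x n)
  #occ-split-zero x n nz = trans (#occ-split x n nz)
    (trans (+-assoc (#occ k (x ++ [ zero ]) n) _ _)
           (cong (λ s → #occ k (x ++ [ zero ]) n + (s + tailMatch x n)) (sym (patternCount-extensions x n))))

-- Base-k expansions and their lowest digits; here k ≥ 2 is used, to bound the fuel.
module Expansions (k′ : ℕ) (k≥2 : 2 ≤ suc k′) where

  open Words k′

  -- (n)_k, and the bound (m+1)/k ≤ m which makes the fuel n sufficient for (n)_k.
  expand : ℕ → Word k
  expand = expansion k

  quotient-< : ∀ m → suc m / k ≤ m
  quotient-< m = s≤s⁻¹ (m/n<m (suc m) k k≥2)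

  digitsFuel-irrelevant : ∀ f g q → q ≤ f → q ≤ g → digitsFuel k f q ≡ digitsFuel k g q
  digitsFuel-irrelevant zero    zero    q       _       _       = refl
  digitsFuel-irrelevant zero    (suc g) zero    _       _       = refl
  digitsFuel-irrelevant (suc f) zero    zero    _       _       = refl
  digitsFuel-irrelevant (suc f) (suc g) zero    _       _       = refl
  digitsFuel-irrelevant (suc f) (suc g) (suc q) (s≤s q≤f) (s≤s q≤g) =
    cong (_++ _) (digitsFuel-irrelevant f g (suc q / k) (≤-trans (quotient-< q) q≤f) (≤-trans (quotient-< q) q≤g))

  expand-suc : ∀ m → expand (suc m) ≡ expand (suc m / k) ++ [ suc m mod k ]
  expand-suc m = cong (_++ [ suc m mod k ]) (digitsFuel-irrelevant m (suc m / k) (suc m / k) (quotient-< m) ≤-refl)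

  mod-cong : ∀ m m′ → m % k ≡ m′ % k → m mod k ≡ m′ mod k
  mod-cong m m′ eq = fromℕ<-cong _ _ eq (m%n<n m k) (m%n<n m′ k)

  expand-k* : ∀ n → expand (k * suc n) ≡ expand (suc n) ++ [ zero ]
  expand-k* n = trans (expand-suc (n + k′ * suc n)) (cong₂ (λ q r → expand q ++ [ r ]) quotient remainder)
    where
    quotient : (k * suc n) / k ≡ suc n
    quotient = trans (/-congˡ {o = k} (*-comm k (suc n))) (m*n/n≡m (suc n) k)
    remainder : (k * suc n) mod k ≡ zero
    remainder = mod-cong (k * suc n) 0 (trans (%-congˡ {o = k} (*-comm k (suc n))) (m*n%n≡0 (suc n) k))

  lastDigits : ℕ → ℕ → Word k
  lastDigits zero    n = []
  lastDigits (suc L) n = lastDigits L (n / k) ++ [ n mod k ]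

  lastDigits-periodic : ∀ L M n → L ≤ M → lastDigits L (n + k ^ M) ≡ lastDigits L n
  lastDigits-periodic zero    M       n _         = refl
  lastDigits-periodic (suc L) (suc M) n (s≤s L≤M) =
    cong₂ _++_ (trans (cong (lastDigits L) shift-quotient) (lastDigits-periodic L M (n / k) L≤M))
               (cong [_] shift-remainder)
    where
    k^[1+M] : k ^ suc M ≡ k ^ M * k
    k^[1+M] = *-comm k (k ^ M)
    shift-quotient : (n + k ^ suc M) / k ≡ n / k + k ^ M
    shift-quotient = trans (/-congˡ {o = k} (cong (n +_) k^[1+M]))
      (trans (+-distrib-/-∣ʳ n (divides (k ^ M) refl)) (cong (n / k +_) (m*n/n≡m (k ^ M) k)))
    shift-remainder : (n + k ^ suc M) mod k ≡ n mod k
    shift-remainder = mod-cong (n + k ^ suc M) n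
      (trans (%-congˡ {o = k} (cong (n +_) k^[1+M])) ([m+kn]%n≡m%n n (k ^ M) k))

  lastDigits-zero : ∀ L → lastDigits L 0 ≡ zeros L
  lastDigits-zero zero    = refl
  lastDigits-zero (suc L) = trans (cong (_++ [ zero ]) (lastDigits-zero L)) (replicate-snoc L zero)

  lastLetters-padded : ∀ L j n → L ≤ j → lastLetters L (zeros j ++ expand n) ≡ lastDigits L n
  lastLetters-padded zero    j n       _   = drop-all (length (zeros j ++ expand n) ∸ 0) _ ≤-refl
  lastLetters-padded (suc L) j zero    L<j = begin
    lastLetters (suc L) (zeros j ++ [])  ≡⟨ cong (lastLetters (suc L)) (++-identityʳ (zeros j)) ⟩
    drop (length (zeros j) ∸ suc L) (zeros j)
      ≡⟨ cong (λ i → drop (i ∸ suc L) (zeros j)) (length-replicate j) ⟩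
    drop (j ∸ suc L) (zeros j)           ≡⟨ drop-replicate (j ∸ suc L) j zero ⟩
    zeros (j ∸ (j ∸ suc L))              ≡⟨ cong zeros (m∸[m∸n]≡n L<j) ⟩
    zeros (suc L)                        ≡⟨ sym (lastDigits-zero (suc L)) ⟩
    lastDigits (suc L) 0                 ∎
    where open ≡-Reasoning
  lastLetters-padded (suc L) j (suc m) L<j = begin
    lastLetters (suc L) (zeros j ++ expand (suc m))
      ≡⟨ cong (λ w → lastLetters (suc L) (zeros j ++ w)) (expand-suc m) ⟩
    lastLetters (suc L) (zeros j ++ (expand (suc m / k) ++ [ suc m mod k ]))
      ≡⟨ cong (lastLetters (suc L)) (sym (++-assoc (zeros j) (expand (suc m / k)) _)) ⟩
    lastLetters (suc L) ((zeros j ++ expand (suc m / k)) ++ [ suc m mod k ])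
      ≡⟨ lastLetters-snoc L (zeros j ++ expand (suc m / k)) _ long-enough ⟩
    lastLetters L (zeros j ++ expand (suc m / k)) ++ [ suc m mod k ]
      ≡⟨ cong (_++ [ suc m mod k ]) (lastLetters-padded L j (suc m / k) L≤j) ⟩
    lastDigits (suc L) (suc m)
      ∎
    where
    open ≡-Reasoning
    L≤j : L ≤ j
    L≤j = ≤-trans (n≤1+n L) L<j
    long-enough : L ≤ length (zeros j ++ expand (suc m / k))
    long-enough = ≤-trans L≤j (subst (_≤ length (zeros j ++ _)) (length-replicate j) (length-++-≤ˡ (zeros j)))

  tailMatch-lastDigits : ∀ x n → ¬ IsZeroWord k x → tailMatch x n ≡ ind (does (x ≟ʷ lastDigits (length x) n))
  tailMatch-lastDigits []      n       nz = ⊥-elim (nz [])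
  tailMatch-lastDigits (a ∷ x) zero    nz =
    trans (endCount-short (a ∷ x) (zeros (length x) ++ []) too-short)
          (sym (ind-≢ (a ∷ x) _ λ e → nz (subst (IsZeroWord k) (sym (trans e (lastDigits-zero (suc (length x))))) zeros-zero)))
    where
    too-short : length (zeros (length x) ++ []) < suc (length x)
    too-short = s≤s (≤-reflexive (trans (cong length (++-identityʳ (zeros (length x)))) (length-replicate (length x))))
    zeros-zero : ∀ {L} → IsZeroWord k (zeros L)
    zeros-zero {zero}  = []
    zeros-zero {suc L} = refl ∷ zeros-zero
  tailMatch-lastDigits (a ∷ x) (suc m) nz = begin
    endCount (a ∷ x) W                                  ≡⟨ endCount-last (a ∷ x) W long-enough ⟩
    ind (does ((a ∷ x) ≟ʷ lastLetters L W))             ≡⟨ cong (λ w → ind (does ((a ∷ x) ≟ʷ w)))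
                                                                (sym (lastLetters-cons L zero W long-enough)) ⟩
    ind (does ((a ∷ x) ≟ʷ lastLetters L (zeros L ++ expand (suc m))))
                                                        ≡⟨ cong (λ w → ind (does ((a ∷ x) ≟ʷ w)))
                                                                (lastLetters-padded L L (suc m) ≤-refl) ⟩
    ind (does ((a ∷ x) ≟ʷ lastDigits L (suc m)))        ∎
    where
    open ≡-Reasoning
    L : ℕ
    L = suc (length x)
    W : Word k
    W = zeros (length x) ++ expand (suc m)
    expansion-nonempty : 1 ≤ length (expand (suc m))
    expansion-nonempty = subst (λ w → 1 ≤ length w) (sym (expand-suc m))
      (subst (1 ≤_) (sym (length-snoc (expand (suc m / k)) _)) (s≤s z≤n))
    long-enough : L ≤ length W
    long-enough = subst (L ≤_) (sym (length-++ (zeros (length x))))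
      (subst (λ q → L ≤ q + length (expand (suc m))) (sym (length-replicate (length x)))
        (≤-trans (≤-reflexive (+-comm 1 (length x))) (+-monoʳ-≤ (length x) expansion-nonempty)))

  tailMatch-periodic : ∀ x M → ¬ IsZeroWord k x → length x ≤ M → ∀ n → tailMatch x (n + k ^ M) ≡ tailMatch x n
  tailMatch-periodic x M nz x≤M n = begin
    tailMatch x (n + k ^ M)                             ≡⟨ tailMatch-lastDigits x _ nz ⟩
    ind (does (x ≟ʷ lastDigits (length x) (n + k ^ M))) ≡⟨ cong (λ w → ind (does (x ≟ʷ w)))
                                                                (lastDigits-periodic (length x) M n x≤M) ⟩
    ind (does (x ≟ʷ lastDigits (length x) n))           ≡⟨ sym (tailMatch-lastDigits x n nz) ⟩
    tailMatch x n                                       ∎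
    where open ≡-Reasoning

  #occ-k* : ∀ w → EndsNonzero w → ∀ n → #occ k w (k * n) ≡ #occ k w n
  #occ-k* w _               zero    = cong (#occ k w) (*-comm k 0)
  #occ-k* w (y , c , refl) (suc m) = begin
    occ w (Z ++ expand (k * suc m))          ≡⟨ cong (λ t → occ w (Z ++ t)) (expand-k* m) ⟩
    occ w (Z ++ (expand (suc m) ++ [ zero ])) ≡⟨ cong (occ w) (sym (++-assoc Z (expand (suc m)) [ zero ])) ⟩
    occ w ((Z ++ expand (suc m)) ++ [ zero ]) ≡⟨ occurrences-snoc-zero y c (Z ++ expand (suc m)) ⟩
    occ w (Z ++ expand (suc m))              ∎
    where
    open ≡-Reasoning
    Z : Word k
    Z = zeros (length w ∸ 1)

  patternCount-k* : ∀ B → All EndsNonzero B → ∀ n → patternCount B (k * n) ≡ patternCount B n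
  patternCount-k* []      _          n = refl
  patternCount-k* (w ∷ B) (ew ∷ eB) n = cong₂ _+_ (#occ-k* w ew n) (patternCount-k* B eB n)

module Reductions (k′ : ℕ) (k≥2 : 2 ≤ suc k′) where

  open Words k′
  open Expansions k′ k≥2

  record Reduction (ℓ : ℕ) (A : List (Word k)) : Set where
    field
      words       : List (Word k)
      remainder   : ℕ → ℕ
      endsNonzero : All EndsNonzero words
      short       : All (λ w → length w ≤ ℓ) words
      periodic    : ∀ n → remainder (n + k ^ (ℓ ∸ 1)) ≡ remainder n
      parity      : ∀ n → patternCount A n ≡₂ patternCount words n + remainder n

  open Reduction

  reduce-[] : ∀ {ℓ} → Reduction ℓ []
  reduce-[] = record
    { words = [] ; remainder = λ _ → 0 ; endsNonzero = [] ; short = []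
    ; periodic = λ _ → refl ; parity = λ _ → ≡₂-refl }

  reduce-++ : ∀ {ℓ A B} → Reduction ℓ A → Reduction ℓ B → Reduction ℓ (A ++ B)
  reduce-++ {ℓ} {A} {B} RA RB = record
    { words       = words RA ++ words RB
    ; remainder   = λ n → remainder RA n + remainder RB n
    ; endsNonzero = ++⁺ (endsNonzero RA) (endsNonzero RB)
    ; short       = ++⁺ (short RA) (short RB)
    ; periodic    = λ n → cong₂ _+_ (periodic RA n) (periodic RB n)
    ; parity      = parity-++
    }
    where
    parity-++ : ∀ n → patternCount (A ++ B) n ≡₂
                      patternCount (words RA ++ words RB) n + (remainder RA n + remainder RB n)
    parity-++ n = begin
      patternCount (A ++ B) n                  ≡⟨ weight-++ _ A B ⟩
      patternCount A n + patternCount B n      ≈⟨ ≡₂-+ (parity RA n) (parity RB n) ⟩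
      (WA + rA) + (WB + rB)                    ≡⟨ interchange WA rA WB rB ⟩
      (WA + WB) + (rA + rB)                    ≡⟨ cong (_+ (rA + rB)) (weight-++ _ (words RA) (words RB)) ⟨
      patternCount (words RA ++ words RB) n + (rA + rB) ∎
      where
      open ≡₂-Reasoning
      WA = patternCount (words RA) n
      WB = patternCount (words RB) n
      rA = remainder RA n
      rB = remainder RB n

  -- If v ends in a
  -- nonzero letter it is its own reduction; if v = x0, the splitting of #(x,n) expresses
  -- #(x0,n) through #(x,n) (reduced recursively), the extensions of x by nonzero letters, and
  -- the boundary term tailMatch x, which is k^(ℓ-1)-periodic as |x| ≤ ℓ - 1.
  reduce-word : ∀ {ℓ v} → Reverse v → ¬ IsZeroWord k v → length v ≤ ℓ → Reduction ℓ [ v ]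
  reduce-word []                nz  _   = ⊥-elim (nz [])
  reduce-word (y ∶ _ ∶ʳ suc c) _   v≤ℓ = record
    { words = [ y ++ [ suc c ] ] ; remainder = λ _ → 0 ; endsNonzero = (y , c , refl) ∷ []
    ; short = v≤ℓ ∷ [] ; periodic = λ _ → refl ; parity = λ _ → ≡⇒≡₂ (sym (+-identityʳ _)) }
  reduce-word {ℓ} (x ∶ rx ∶ʳ zero) nz x0≤ℓ = record
    { words       = words R ++ extensions x
    ; remainder   = λ n → remainder R n + tailMatch x n
    ; endsNonzero = ++⁺ (endsNonzero R) (tabulate⁺ (λ i → x , i , refl))
    ; short       = ++⁺ (short R) (tabulate⁺ extension-short)
    ; periodic    = λ n → cong₂ _+_ (periodic R n) (tailMatch-periodic x (ℓ ∸ 1) nz-x (∸-monoˡ-≤ 1 x<ℓ) n)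
    ; parity      = parity-x0
    }
    where
    nz-x : ¬ IsZeroWord k x
    nz-x zx = nz (++⁺ zx (refl ∷ []))
    x<ℓ : suc (length x) ≤ ℓ
    x<ℓ = subst (_≤ ℓ) (length-snoc x zero) x0≤ℓ
    R : Reduction ℓ [ x ]
    R = reduce-word rx nz-x (≤-trans (n≤1+n _) x<ℓ)
    extension-short : ∀ i → length (x ++ [ suc i ]) ≤ ℓ
    extension-short i = subst (_≤ ℓ) (sym (length-snoc x (suc i))) x<ℓ
    parity-x0 : ∀ n → patternCount [ x ++ [ zero ] ] n ≡₂
                      patternCount (words R ++ extensions x) n + (remainder R n + tailMatch x n)
    parity-x0 n = begin
      #occ k (x ++ [ zero ]) n + 0    ≡⟨ +-identityʳ _ ⟩
      #occ k (x ++ [ zero ]) n        ≈⟨ ≡₂-unshift _ (S + T) X (≡⇒≡₂ (sym (#occ-split-zero x n nz-x))) ⟩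
      X + (S + T)                     ≈⟨ ≡₂-+ x-reduced ≡₂-refl ⟩
      (Wx + rx′) + (S + T)            ≡⟨ interchange Wx rx′ S T ⟩
      (Wx + S) + (rx′ + T)            ≡⟨ cong (_+ (rx′ + T)) (weight-++ _ (words R) (extensions x)) ⟨
      patternCount (words R ++ extensions x) n + (rx′ + T) ∎
      where
      open ≡₂-Reasoning
      X   = #occ k x n
      S   = patternCount (extensions x) n
      T   = tailMatch x n
      Wx  = patternCount (words R) n
      rx′ = remainder R n
      x-reduced : X ≡₂ Wx + rx′
      x-reduced = ≡₂-trans (≡⇒≡₂ (sym (+-identityʳ X))) (parity R n)

  reduce : ∀ {ℓ} A → All (λ v → ¬ IsZeroWord k v) A → All (λ v → length v ≤ ℓ) A → Reduction ℓ A
  reduce []      []         []         = reduce-[]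
  reduce (v ∷ A) (nz ∷ nzs) (v≤ℓ ∷ ls) = reduce-++ (reduce-word (reverseView v) nz v≤ℓ) (reduce A nzs ls)

  correction : ∀ {ℓ A} → Reduction ℓ A → ℕ → ℤ
  correction R = aSeq k (oddPart (words R))
    where open OddPart _≟ʷ_

  correction-isPCS : ∀ {ℓ A} (R : Reduction ℓ A) → IsPCS k ℓ (correction R)
  correction-isPCS R =
    oddPart (words R) ,
    (oddPart-Unique (words R) , All.map endsNonzero⇒nonzero (oddPart-All (words R) (endsNonzero R))) ,
    oddPart-All (words R) (short R) ,
    λ _ → refl
    where open OddPart _≟ʷ_

  correction-invariant : ∀ {ℓ A} (R : Reduction ℓ A) → ∀ n → correction R (k * n) ≡ correction R n
  correction-invariant R n =
    cong sgn (patternCount-k* (oddPart (words R)) (oddPart-All (words R) (endsNonzero R)) n)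
    where open OddPart _≟ʷ_

  correction-quotient : ∀ {ℓ A} (R : Reduction ℓ A) → ∀ n → (aSeq k A /ₛ correction R) n ≡ sgn (remainder R n)
  correction-quotient {A = A} R n = sgn-quotient (patternCount A n) (patternCount (oddPart (words R)) n)
    (remainder R n)
    (≡₂-trans (parity R n) (≡₂-+ (oddPart-parity (λ v → #occ k v n) (words R)) ≡₂-refl))
    where open OddPart _≟ʷ_

lemma2p9 : (k : ℕ) .{{_ : NonZero k}} → 2 ≤ k → (ℓ : ℕ) (a : ℕ → ℤ) → IsPCS k ℓ a →
    Σ (ℕ → ℤ) λ b →
      (IsPCS k ℓ b × (∀ n → b (k * n) ≡ b n) × Periodic (k ^ (ℓ ∸ 1)) (a /ₛ b))
      × (∀ (b′ : ℕ → ℤ) →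
           IsPCS k ℓ b′ × (∀ n → b′ (k * n) ≡ b′ n) × Periodic (k ^ (ℓ ∸ 1)) (a /ₛ b′) →
           ∀ n → b′ n ≡ b n)
lemma2p9 (suc k′) k≥2 ℓ a a-pcs@(A , (_ , nzA) , shortA , a≗) =
  b , (correction-isPCS R , correction-invariant R , quotient-periodic) , uniqueness
  where
  open Words k′
  open Reductions k′ k≥2
  R : Reduction ℓ A
  R = reduce A nzA shortA
  b : ℕ → ℤ
  b = correction R
  quotient : ∀ n → (a /ₛ b) n ≡ sgn (Reduction.remainder R n)
  quotient n = trans (cong (ℤ._* b n) (a≗ n)) (correction-quotient R n)
  quotient-periodic : Periodic (k ^ (ℓ ∸ 1)) (a /ₛ b)
  quotient-periodic n =
    trans (quotient _) (trans (cong sgn (Reduction.periodic R n)) (sym (quotient n)))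
  uniqueness : ∀ b′ → IsPCS k ℓ b′ × (∀ n → b′ (k * n) ≡ b′ n) × Periodic (k ^ (ℓ ∸ 1)) (a /ₛ b′) →
               ∀ n → b′ n ≡ b n
  uniqueness b′ (b′-pcs , b′-invariant , b′-periodic) =
    invariant-unique k (ℓ ∸ 1) a b′ b (pcs-square a-pcs) b′-invariant b′-periodic
      (correction-invariant R) quotient-periodic
      (trans (pcs-at-zero b′-pcs) (sym (pcs-at-zero (correction-isPCS R))))
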